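{- Let $n\ge 1$ and let $k\ge 0$ be an integer. Then $\tau_k(P_n)=\left\lceil \frac{n}{k+2}\right\rceil$, where $P_n$ is the path on $n$ vertices.
   Context: For a graph $G$ and $X\subseteq V(G)$, vertices $u,v$ are $(X,k)$-visible if some shortest $(u,v)$-path in $G$ has at most $k$ internal vertices in $X$; $X$ is a mutual $k$-visible set if every pair of distinct vertices of $X$ is $(X,k)$-visible. A mutual $k$-visibility cover of $G$ is a partition of $V(G)$ in which every part is a mutual $k$-visible set in $G$; $\tau_k(G)$ is the minimum number of parts of a mutual $k$-visibility cover of $G$. -}

module Defs where

open import Data.Nat using (ℕ; zero; suc; _+_; _≤_)
open import Data.Nat.DivMod using (_/_)
open import Data.Fin using (Fin; toℕ; _≟_)
open import Data.Fin.Subset using (Subset; _∈_)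
open import Data.Fin.Subset.Properties using (_∈?_)
open import Data.List using (List; []; _∷_; length; filter)
open import Data.Vec using (tabulate)
open import Data.Product using (Σ; ∃; _×_)
open import Data.Sum using (_⊎_)
open import Relation.Nullary using (¬_)
open import Relation.Nullary.Decidable using (⌊_⌋)
open import Relation.Binary.PropositionalEquality using (_≡_; _≢_)

record Graph (n : ℕ) : Set₁ where
  field
    Adj     : Fin n → Fin n → Set
    sym     : ∀ {u v} → Adj u v → Adj v u
    irrefl  : ∀ {u} → ¬ Adj u u
open Graph public

P : (n : ℕ) → Graph n
P n = record
  { Adj    = λ i j → (suc (toℕ i) ≡ toℕ j) ⊎ (suc (toℕ j) ≡ toℕ i)
  ; sym    = symP
  ; irrefl = irreflP
  }
  where
  open import Data.Sum using (inj₁; inj₂; [_,_])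
  open import Data.Nat.Properties using (1+n≢n)
  symP : ∀ {u v : Fin n} → (suc (toℕ u) ≡ toℕ v) ⊎ (suc (toℕ v) ≡ toℕ u)
                         → (suc (toℕ v) ≡ toℕ u) ⊎ (suc (toℕ u) ≡ toℕ v)
  symP (inj₁ e) = inj₂ e
  symP (inj₂ e) = inj₁ e
  irreflP : ∀ {u : Fin n} → ¬ ((suc (toℕ u) ≡ toℕ u) ⊎ (suc (toℕ u) ≡ toℕ u))
  irreflP {u} (inj₁ e) = 1+n≢n e
  irreflP {u} (inj₂ e) = 1+n≢n e

module _ {n : ℕ} (G : Graph n) where

  data Walk : Fin n → Fin n → Set where
    stop : (u : Fin n) → Walk u u
    step : (u : Fin n) {w v : Fin n} → Adj G u w → Walk w v → Walk u v

  len : ∀ {u v} → Walk u v → ℕ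
  len (stop _)     = 0
  len (step _ _ p) = suc (len p)

  allButLast : ∀ {u v} → Walk u v → List (Fin n)
  allButLast (stop _)     = []
  allButLast (step u _ p) = u ∷ allButLast p

  internal : ∀ {u v} → Walk u v → List (Fin n)
  internal (stop _)     = []
  internal (step _ _ p) = allButLast p

  -- a shortest (u,v)-path: a (u,v)-walk of minimum length
  -- (a minimum-length walk is automatically a path)
  IsShortest : ∀ {u v} → Walk u v → Set
  IsShortest {u} {v} p = (q : Walk u v) → len p ≤ len q

  internalIn : ∀ {u v} → Subset n → Walk u v → ℕ
  internalIn X p = length (filter (λ x → x ∈? X) (internal p))

  Visible : Subset n → ℕ → Fin n → Fin n → Set
  Visible X k u v = Σ (Walk u v) λ p → IsShortest p × (internalIn X p ≤ k)

  MutualVisible : ℕ → Subset n → Set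
  MutualVisible k X = ∀ u v → u ∈ X → v ∈ X → u ≢ v → Visible X k u v

  part : ∀ {m} → (Fin n → Fin m) → Fin m → Subset n
  part c i = tabulate (λ v → ⌊ c v ≟ i ⌋)

  -- a mutual k-visibility cover with exactly m parts, given as a surjective
  -- labelling c : V(G) → Fin m (parts = fibres, all nonempty) such that every
  -- part is a mutual k-visible set in G
  IsCover : ℕ → (m : ℕ) → (Fin n → Fin m) → Set
  IsCover k m c = (∀ i → ∃ λ v → c v ≡ i) × (∀ i → MutualVisible k (part c i))

  HasCover : ℕ → ℕ → Set
  HasCover k m = ∃ λ (c : Fin n → Fin m) → IsCover k m c

  IsTau : ℕ → ℕ → Set
  IsTau k t = HasCover k t × (∀ m → HasCover k m → t ≤ m)

-- ⌈ a / b ⌉ for b = suc d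
ceilDiv : ℕ → (d : ℕ) → ℕ
ceilDiv a d = (a + d) / suc d

{-# OPTIONS --safe #-}
-- In P_n a shortest path between two vertices is unique: it runs through
-- every vertex between them.  So if a mutual k-visible set had k + 3
-- vertices, the path between its two extreme vertices would carry the other
-- k + 1 as internal vertices; hence every part of a cover has at most k + 2
-- vertices and a cover with m parts has n ≤ m (k + 2).  Conversely, cutting
-- the path into consecutive blocks of k + 2 vertices, x ↦ ⌊x / (k + 2)⌋,
-- gives ⌈n / (k + 2)⌉ parts in which any two vertices have at most k vertices
-- between them.
module Submission where

open import Defs hiding (sym)
open import Data.Nat using (ℕ; zero; suc; _+_; _*_; _∸_; ∣_-_∣; _≤_; _<_; NonZero; z≤n; s≤s; s≤s⁻¹)
open import Data.Nat.Properties
open import Data.Nat.DivMod using (_/_; _%_; m≡m%n+[m/n]*n; m%n<n; m/n*n≤m; m*n/n≡m; m<n*o⇒m/o<n)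
open import Data.Bool using (Bool; true; false)
open import Data.Bool.Properties using (T-≡)
open import Data.Fin as Fin using (Fin; toℕ; fromℕ<)
open import Data.Fin.Patterns using (0F)
open import Data.Fin.Properties using (toℕ<n; toℕ-fromℕ<; toℕ-injective)
open import Data.Fin.Subset using (Subset; _∈_)
open import Data.Fin.Subset.Properties using (_∈?_)
open import Data.List using (length; filter)
open import Data.List.Properties using (length-filter)
open import Data.Vec using ([]; _∷_; here; there; lookup)
open import Data.Vec.Properties using (lookup∘tabulate; []=⇒lookup)
open import Data.Product using (Σ; ∃; _×_; _,_)
open import Data.Sum using (inj₁; inj₂)
open import Data.Empty using (⊥-elim)
open import Function using (_∘_)
open import Function.Bundles using (Equivalence)
open import Relation.Nullary using (does)
open import Relation.Nullary.Decidable using (⌊_⌋; isYes≗does; toWitness)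
open import Relation.Binary.PropositionalEquality
  using (_≡_; refl; sym; trans; cong; cong₂; subst; module ≡-Reasoning)
open import Algebra.Properties.CommutativeSemigroup +-commutativeSemigroup using (x∙yz≈y∙xz)
open import Algebra.Properties.CommutativeMonoid.Sum +-0-commutativeMonoid
  using (sum-syntax; ∑-distrib-+; sum-replicate-zero; sum-cong-≗)

bit : Bool → ℕ
bit false = 0
bit true  = 1

count : (ℕ → Bool) → ℕ → ℕ → ℕ
count g a zero    = 0
count g a (suc d) = bit (g a) + count g (suc a) d

count-suc : ∀ g a d → count g (suc a) d ≡ count (g ∘ suc) a d
count-suc g a zero    = refl
count-suc g a (suc d) = cong (bit (g (suc a)) +_) (count-suc g (suc a) d)

count-snoc : ∀ g a d → count g a (suc d) ≡ bit (g (a + d)) + count g a d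
count-snoc g a zero    rewrite +-identityʳ a = refl
count-snoc g a (suc d) = begin
  bit (g a) + count g (suc a) (suc d)
    ≡⟨ cong (bit (g a) +_) (count-snoc g (suc a) d) ⟩
  bit (g a) + (bit (g (suc a + d)) + count g (suc a) d)
    ≡⟨ x∙yz≈y∙xz (bit (g a)) (bit (g (suc a + d))) _ ⟩
  bit (g (suc a + d)) + count g a (suc d)
    ≡⟨ cong (λ j → bit (g j) + count g a (suc d)) (+-suc a d) ⟨
  bit (g (a + suc d)) + count g a (suc d)
    ∎
  where open ≡-Reasoning

-- The shape of a mutual k-visible set along a path: two of its vertices
-- enclose at most k others.
Sparse : ℕ → (ℕ → Bool) → Set
Sparse k g = ∀ a d → g a ≡ true → g (suc a + d) ≡ true → count g (suc a) d ≤ k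

module _ {k : ℕ} {g : ℕ → Bool} (sparse : Sparse k g) where

  count-after-true≤ : ∀ {a} → g a ≡ true → ∀ d → count g (suc a) d ≤ suc k
  count-after-true≤ ga zero = z≤n
  count-after-true≤ {a} ga (suc d) rewrite count-snoc g (suc a) d with g (suc a + d) in gb
  ... | true  = s≤s (sparse a d ga gb)
  ... | false = count-after-true≤ ga d

  count≤ : ∀ a d → count g a d ≤ 2 + k
  count≤ a zero = z≤n
  count≤ a (suc d) with g a in ga
  ... | true  = s≤s (count-after-true≤ ga d)
  ... | false = count≤ (suc a) d

∑-δ≡1 : ∀ {m} (j : Fin m) → ∑[ i < m ] bit (does (j Fin.≟ i)) ≡ 1
∑-δ≡1 {suc m} 0F          = cong suc (sum-replicate-zero m)
∑-δ≡1 {suc m} (Fin.suc j) = ∑-δ≡1 j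

∑f≤m*c : ∀ {m c} (f : Fin m → ℕ) → (∀ i → f i ≤ c) → ∑[ i < m ] f i ≤ m * c
∑f≤m*c {zero}  f f≤c = z≤n
∑f≤m*c {suc m} f f≤c = +-mono-≤ (f≤c 0F) (∑f≤m*c (f ∘ Fin.suc) (f≤c ∘ Fin.suc))

indicator : ∀ {n} → Subset n → ℕ → Bool
indicator []      _       = false
indicator (b ∷ X) zero    = b
indicator (b ∷ X) (suc j) = indicator X j

indicator-toℕ : ∀ {n} (X : Subset n) x → indicator X (toℕ x) ≡ does (x ∈? X)
indicator-toℕ (true  ∷ X) 0F          = refl
indicator-toℕ (false ∷ X) 0F          = refl
indicator-toℕ (b     ∷ X) (Fin.suc x) = indicator-toℕ X x

indicator-true : ∀ {n} (X : Subset n) j → indicator X j ≡ true → ∃ λ x → toℕ x ≡ j × x ∈ X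
indicator-true (true ∷ X) zero    refl = 0F , refl , here
indicator-true (b    ∷ X) (suc j) e with indicator-true X j e
... | x , refl , x∈X = Fin.suc x , refl , there x∈X

∈-part⇒ : ∀ {n m} (G : Graph n) (c : Fin n → Fin m) {i x} → x ∈ part G c i → c x ≡ i
∈-part⇒ G c {i} {x} x∈ = toWitness (Equivalence.from T-≡ (begin
  ⌊ c x Fin.≟ i ⌋        ≡⟨ lookup∘tabulate (λ v → ⌊ c v Fin.≟ i ⌋) x ⟨
  lookup (part G c i) x  ≡⟨ []=⇒lookup x∈ ⟩
  true                   ∎))
  where open ≡-Reasoning

∑-count-part : ∀ {n m} (c : Fin n → Fin m) → ∑[ i < m ] count (indicator (part (P n) c i)) 0 n ≡ n
∑-count-part {zero}  {m} c = sum-replicate-zero m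
∑-count-part {suc n} {m} c = begin
  ∑[ i < m ] count (indicator (part (P (suc n)) c i)) 0 (suc n)
    ≡⟨ sum-cong-≗ (λ i → cong₂ _+_ (cong bit (isYes≗does (c 0F Fin.≟ i))) (count-suc _ 0 n)) ⟩
  ∑[ i < m ] (δ i + rest i)
    ≡⟨ ∑-distrib-+ δ rest ⟩
  ∑[ i < m ] δ i + ∑[ i < m ] rest i
    ≡⟨ cong₂ _+_ (∑-δ≡1 (c 0F)) (∑-count-part (c ∘ Fin.suc)) ⟩
  1 + n
    ∎
  where
  open ≡-Reasoning
  δ rest : Fin m → ℕ
  δ i    = bit (does (c 0F Fin.≟ i))
  rest i = count (indicator (part (P n) (c ∘ Fin.suc) i)) 0 n

m<[1+m/o]*o : ∀ m o .{{_ : NonZero o}} → m < suc (m / o) * o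
m<[1+m/o]*o m o = begin-strict
  m                 ≡⟨ m≡m%n+[m/n]*n m o ⟩
  m % o + m / o * o <⟨ +-monoˡ-< (m / o * o) (m%n<n m o) ⟩
  o + m / o * o     ∎
  where open ≤-Reasoning

m/o≡n/o⇒m<n+o : ∀ {m n o} .{{_ : NonZero o}} → m / o ≡ n / o → m < n + o
m/o≡n/o⇒m<n+o {m} {n} {o} eq = begin-strict
  m             <⟨ m<[1+m/o]*o m o ⟩
  o + m / o * o ≡⟨ cong (λ q → o + q * o) eq ⟩
  o + n / o * o ≤⟨ +-monoʳ-≤ o (m/n*n≤m n o) ⟩
  o + n         ≡⟨ +-comm o n ⟩
  n + o         ∎
  where open ≤-Reasoning

m/o≡n/o⇒∣m-n∣<o : ∀ {m n o} .{{_ : NonZero o}} → m / o ≡ n / o → ∣ m - n ∣ < o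
m/o≡n/o⇒∣m-n∣<o {m} {n} eq with ∣m-n∣≡[m∸n]∨[n∸m] m n
... | inj₁ e = subst (_< _) (sym e) (m<n+o⇒m∸n<o m n (m/o≡n/o⇒m<n+o eq))
... | inj₂ e = subst (_< _) (sym e) (m<n+o⇒m∸n<o n m (m/o≡n/o⇒m<n+o (sym eq)))

n≤m*[1+d]⇒ceilDiv≤m : ∀ {n m} d → n ≤ m * suc d → ceilDiv n d ≤ m
n≤m*[1+d]⇒ceilDiv≤m {n} {m} d n≤m*[1+d] = s≤s⁻¹ (m<n*o⇒m/o<n (begin-strict
  n + d              <⟨ +-monoʳ-< n (n<1+n d) ⟩
  n + suc d          ≤⟨ +-monoˡ-≤ (suc d) n≤m*[1+d] ⟩
  m * suc d + suc d  ≡⟨ +-comm (m * suc d) (suc d) ⟩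
  suc m * suc d      ∎))
  where open ≤-Reasoning

ceilDiv≤m⇒n≤m*[1+d] : ∀ {n m} d → ceilDiv n d ≤ m → n ≤ m * suc d
ceilDiv≤m⇒n≤m*[1+d] {n} {m} d ceilDiv≤m = +-cancelˡ-≤ d n (m * suc d) (s≤s⁻¹ (begin-strict
  d + n                      ≡⟨ +-comm d n ⟩
  n + d                      <⟨ m<[1+m/o]*o (n + d) (suc d) ⟩
  suc (ceilDiv n d) * suc d  ≤⟨ *-monoˡ-≤ (suc d) (s≤s ceilDiv≤m) ⟩
  suc d + m * suc d          ∎))
  where open ≤-Reasoning

m/[1+d]<ceilDiv : ∀ {m n} d → m < n → m / suc d < ceilDiv n d
m/[1+d]<ceilDiv {m} d m<n = ≰⇒> λ ceilDiv≤ →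
  <⇒≱ (≤-<-trans (m/n*n≤m m (suc d)) m<n) (ceilDiv≤m⇒n≤m*[1+d] d ceilDiv≤)

m<ceilDiv⇒m*[1+d]<n : ∀ {m n} d → m < ceilDiv n d → m * suc d < n
m<ceilDiv⇒m*[1+d]<n d m<ceilDiv = ≰⇒> λ n≤ → <⇒≱ m<ceilDiv (n≤m*[1+d]⇒ceilDiv≤m d n≤)

module _ {n : ℕ} where

  adjacent⇒∣-∣≡1 : ∀ {u w} → Adj (P n) u w → ∣ toℕ u - toℕ w ∣ ≡ 1
  adjacent⇒∣-∣≡1 {u} (inj₁ e) = subst (λ j → ∣ toℕ u - j ∣ ≡ 1) e ∣u-1+u∣≡1
    where
    ∣u-1+u∣≡1 : ∣ toℕ u - suc (toℕ u) ∣ ≡ 1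
    ∣u-1+u∣≡1 = trans (m≤n⇒∣m-n∣≡n∸m (n≤1+n (toℕ u))) (m+n∸n≡m 1 (toℕ u))
  adjacent⇒∣-∣≡1 {u} {w} (inj₂ e) =
    trans (∣-∣-comm (toℕ u) (toℕ w)) (adjacent⇒∣-∣≡1 (inj₁ e))

  ∣-∣≤len : ∀ {u v} (p : Walk (P n) u v) → ∣ toℕ u - toℕ v ∣ ≤ len (P n) p
  ∣-∣≤len (stop u)               = ≤-reflexive (∣n-n∣≡0 (toℕ u))
  ∣-∣≤len (step u {w} {v} u~w p) = begin
    ∣ toℕ u - toℕ v ∣
      ≤⟨ ∣-∣-triangle (toℕ u) (toℕ w) (toℕ v) ⟩
    ∣ toℕ u - toℕ w ∣ + ∣ toℕ w - toℕ v ∣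
      ≤⟨ +-mono-≤ (≤-reflexive (adjacent⇒∣-∣≡1 u~w)) (∣-∣≤len p) ⟩
    1 + len (P n) p
      ∎
    where open ≤-Reasoning

  ascendingWalk : ∀ d (u v : Fin n) → toℕ u + d ≡ toℕ v →
                  Σ (Walk (P n) u v) λ p → len (P n) p ≡ d
  ascendingWalk zero u v u+0≡v with toℕ-injective (trans (sym (+-identityʳ (toℕ u))) u+0≡v)
  ... | refl = stop u , refl
  ascendingWalk (suc d) u v u+[1+d]≡v =
    let p , len-p = ascendingWalk d w v w+d≡v in step u (inj₁ (sym (toℕ-fromℕ< 1+u<n))) p , cong suc len-p
    where
    1+u+d≡v : suc (toℕ u + d) ≡ toℕ v
    1+u+d≡v = trans (sym (+-suc (toℕ u) d)) u+[1+d]≡v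
    1+u<n : suc (toℕ u) < n
    1+u<n = ≤-<-trans (s≤s (m≤m+n (toℕ u) d)) (subst (_< n) (sym 1+u+d≡v) (toℕ<n v))
    w = fromℕ< 1+u<n
    w+d≡v : toℕ w + d ≡ toℕ v
    w+d≡v = trans (cong (_+ d) (toℕ-fromℕ< 1+u<n)) 1+u+d≡v

  descendingWalk : ∀ d (u v : Fin n) → toℕ v + d ≡ toℕ u →
                   Σ (Walk (P n) u v) λ p → len (P n) p ≡ d
  descendingWalk zero u v v+0≡u with toℕ-injective (trans (sym (+-identityʳ (toℕ v))) v+0≡u)
  ... | refl = stop u , refl
  descendingWalk (suc d) u v v+[1+d]≡u =
    let p , len-p = descendingWalk d w v (sym (toℕ-fromℕ< v+d<n)) in step u (inj₂ 1+w≡u) p , cong suc len-p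
    where
    1+v+d≡u : suc (toℕ v + d) ≡ toℕ u
    1+v+d≡u = trans (sym (+-suc (toℕ v) d)) v+[1+d]≡u
    v+d<n : toℕ v + d < n
    v+d<n = <-trans (≤-reflexive 1+v+d≡u) (toℕ<n u)
    w = fromℕ< v+d<n
    1+w≡u : suc (toℕ w) ≡ toℕ u
    1+w≡u = trans (cong suc (toℕ-fromℕ< v+d<n)) 1+v+d≡u

  distanceWalk : ∀ u v → Σ (Walk (P n) u v) λ p → len (P n) p ≡ ∣ toℕ u - toℕ v ∣
  distanceWalk u v with ≤-total (toℕ u) (toℕ v)
  ... | inj₁ u≤v =
    let p , len-p = ascendingWalk (toℕ v ∸ toℕ u) u v (m+[n∸m]≡n u≤v) in
    p , trans len-p (sym (m≤n⇒∣m-n∣≡n∸m u≤v))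
  ... | inj₂ v≤u =
    let p , len-p = descendingWalk (toℕ u ∸ toℕ v) u v (m+[n∸m]≡n v≤u) in
    p , trans len-p (sym (m≤n⇒∣n-m∣≡n∸m v≤u))

  shortestWalk : ∀ u v →
                 Σ (Walk (P n) u v) λ p → IsShortest (P n) p × len (P n) p ≡ ∣ toℕ u - toℕ v ∣
  shortestWalk u v =
    let p , len-p = distanceWalk u v in p , (λ q → ≤-trans (≤-reflexive len-p) (∣-∣≤len q)) , len-p

  shortest⇒len≡∣-∣ : ∀ {u v} (p : Walk (P n) u v) → IsShortest (P n) p →
                     len (P n) p ≡ ∣ toℕ u - toℕ v ∣
  shortest⇒len≡∣-∣ {u} {v} p p-shortest =
    let q , _ , len-q = shortestWalk u v in
    ≤-antisym (≤-trans (p-shortest q) (≤-reflexive len-q)) (∣-∣≤len p)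

  ascending-step : ∀ {u w v} (u~w : Adj (P n) u w) (p : Walk (P n) w v) →
                   toℕ u + suc (len (P n) p) ≡ toℕ v →
                   suc (toℕ u) ≡ toℕ w × toℕ w + len (P n) p ≡ toℕ v
  ascending-step {u} (inj₁ e) p asc =
    e , trans (cong (_+ len (P n) p) (sym e)) (trans (sym (+-suc (toℕ u) _)) asc)
  ascending-step {u} {w} {v} (inj₂ e) p asc = ⊥-elim (<⇒≱ w+L<v v≤w+L)
    where
    L = len (P n) p
    v≤w+L : toℕ v ≤ toℕ w + L
    v≤w+L = ≤-trans (m≤n+∣n-m∣ (toℕ v) (toℕ w)) (+-monoʳ-≤ (toℕ w) (∣-∣≤len p))
    w+L<v : toℕ w + L < toℕ v
    w+L<v = subst (toℕ w + L <_) (trans (cong (_+ suc L) e) asc) (s≤s (+-monoʳ-≤ (toℕ w) (n≤1+n L)))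

  allButLast-ascending : ∀ (X : Subset n) {u v} (p : Walk (P n) u v) → toℕ u + len (P n) p ≡ toℕ v →
                         length (filter (_∈? X) (allButLast (P n) p)) ≡
                         count (indicator X) (toℕ u) (len (P n) p)
  allButLast-ascending X (stop u) _ = refl
  allButLast-ascending X (step u u~w p) asc with ascending-step u~w p asc
  ... | 1+u≡w , asc′ rewrite indicator-toℕ X u | 1+u≡w with does (u ∈? X)
  ...   | true  = cong suc (allButLast-ascending X p asc′)
  ...   | false = allButLast-ascending X p asc′

  internalIn-ascending : ∀ (X : Subset n) {u v} (p : Walk (P n) u v) → toℕ u + len (P n) p ≡ toℕ v →
                         internalIn (P n) X p ≡ count (indicator X) (suc (toℕ u)) (len (P n) p ∸ 1)
  internalIn-ascending X (stop u) _ = refl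
  internalIn-ascending X (step u u~w p) asc with ascending-step u~w p asc
  ... | 1+u≡w , asc′ rewrite 1+u≡w = allButLast-ascending X p asc′

  internalIn≤len∸1 : ∀ (X : Subset n) {u v} (p : Walk (P n) u v) →
                     internalIn (P n) X p ≤ len (P n) p ∸ 1
  internalIn≤len∸1 X p =
    ≤-trans (length-filter (_∈? X) (internal (P n) p)) (≤-reflexive (length-internal p))
    where
    length-allButLast : ∀ {u v} (p : Walk (P n) u v) → length (allButLast (P n) p) ≡ len (P n) p
    length-allButLast (stop _)     = refl
    length-allButLast (step _ _ p) = cong suc (length-allButLast p)
    length-internal : ∀ {u v} (p : Walk (P n) u v) → length (internal (P n) p) ≡ len (P n) p ∸ 1
    length-internal (stop _)     = refl
    length-internal (step _ _ p) = length-allButLast p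

  mutualVisible⇒sparse : ∀ {k X} → MutualVisible (P n) k X → Sparse k (indicator X)
  mutualVisible⇒sparse {k} {X} mv a d Xa Xb
    with indicator-true X a Xa | indicator-true X (suc a + d) Xb
  ... | u , refl , u∈X | v , v≡1+a+d , v∈X
    with mv u v u∈X v∈X (λ u≡v → m≢1+m+n (toℕ u) (trans (cong toℕ u≡v) v≡1+a+d))
  ... | p , p-shortest , p-few = subst (_≤ k) internalIn≡ p-few
    where
    v≡a+[1+d] : toℕ v ≡ toℕ u + suc d
    v≡a+[1+d] = trans v≡1+a+d (sym (+-suc (toℕ u) d))
    len≡1+d : len (P n) p ≡ suc d
    len≡1+d = begin
      len (P n) p               ≡⟨ shortest⇒len≡∣-∣ p p-shortest ⟩
      ∣ toℕ u - toℕ v ∣         ≡⟨ cong (∣ toℕ u -_∣) v≡a+[1+d] ⟩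
      ∣ toℕ u - toℕ u + suc d ∣ ≡⟨ ∣m-m+n∣≡n (toℕ u) (suc d) ⟩
      suc d                     ∎
      where open ≡-Reasoning
    internalIn≡ : internalIn (P n) X p ≡ count (indicator X) (suc a) d
    internalIn≡ = trans (internalIn-ascending X p (trans (cong (toℕ u +_) len≡1+d) (sym v≡a+[1+d])))
                        (cong (λ L → count (indicator X) (suc a) (L ∸ 1)) len≡1+d)

  cover⇒n≤m*[2+k] : ∀ {k m} → HasCover (P n) k m → n ≤ m * (2 + k)
  cover⇒n≤m*[2+k] {k} {m} (c , _ , mv) = subst (_≤ m * (2 + k)) (∑-count-part c)
    (∑f≤m*c _ λ i → count≤ (mutualVisible⇒sparse (mv i)) 0 n)

  module _ (k : ℕ) where

    block : Fin n → Fin (ceilDiv n (suc k))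
    block x = fromℕ< (m/[1+d]<ceilDiv (suc k) (toℕ<n x))

    toℕ-block : ∀ x → toℕ (block x) ≡ toℕ x / (2 + k)
    toℕ-block x = toℕ-fromℕ< _

    block-surjective : ∀ i → ∃ λ x → block x ≡ i
    block-surjective i = x , toℕ-injective (begin
      toℕ (block x)             ≡⟨ toℕ-block x ⟩
      toℕ x / (2 + k)           ≡⟨ cong (_/ (2 + k)) (toℕ-fromℕ< i*[2+k]<n) ⟩
      toℕ i * (2 + k) / (2 + k) ≡⟨ m*n/n≡m (toℕ i) (2 + k) ⟩
      toℕ i                     ∎)
      where
      open ≡-Reasoning
      i*[2+k]<n : toℕ i * (2 + k) < n
      i*[2+k]<n = m<ceilDiv⇒m*[1+d]<n (suc k) (toℕ<n i)
      x = fromℕ< i*[2+k]<n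

    block-mutualVisible : ∀ i → MutualVisible (P n) k (part (P n) block i)
    block-mutualVisible i u v u∈ v∈ _ =
      let p , p-shortest , len-p = shortestWalk u v in
      p , p-shortest ,
      ≤-trans (internalIn≤len∸1 _ p) (∸-monoˡ-≤ 1 (≤-trans (≤-reflexive len-p) ∣u-v∣≤1+k))
      where
      sameBlock : toℕ u / (2 + k) ≡ toℕ v / (2 + k)
      sameBlock = begin
        toℕ u / (2 + k)  ≡⟨ toℕ-block u ⟨
        toℕ (block u)    ≡⟨ cong toℕ (trans (∈-part⇒ (P n) block u∈) (sym (∈-part⇒ (P n) block v∈))) ⟩
        toℕ (block v)    ≡⟨ toℕ-block v ⟩
        toℕ v / (2 + k)  ∎
        where open ≡-Reasoning
      ∣u-v∣≤1+k : ∣ toℕ u - toℕ v ∣ ≤ suc k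
      ∣u-v∣≤1+k = s≤s⁻¹ (m/o≡n/o⇒∣m-n∣<o {toℕ u} {toℕ v} sameBlock)

    blockCover : HasCover (P n) k (ceilDiv n (suc k))
    blockCover = block , block-surjective , block-mutualVisible

path-isTau : ∀ n k → IsTau (P n) k (ceilDiv n (suc k))
path-isTau n k = blockCover k , λ m cover → n≤m*[1+d]⇒ceilDiv≤m (suc k) (cover⇒n≤m*[2+k] cover)

proposition8p7 : (n : ℕ) → 1 ≤ n → (k : ℕ) → IsTau (P n) k (ceilDiv n (k + 1))
proposition8p7 n _ k = subst (IsTau (P n) k ∘ ceilDiv n) (+-comm 1 k) (path-isTau n k)
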